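{- Let $n\ge1$ and let $\tau^{(n)}$ be as defined in the context. For every $(v_1,\dots,v_n)\in\{0,1,2\}^n$, the $n$-th coordinate $t_n$ of $\tau^{(n)}(v_1,\dots,v_n)$ is $$t_n=2^{n-1}\Bigl(v_n+\sum_{i=1}^{n-1}2^{n-1-i}v_i\Bigr)\bmod 3,$$ so that $t_n\equiv 2^{n-1}\widetilde{\widetilde v}_n\pmod 3$, where $\widetilde{\widetilde v}_n=\bigl(v_n+\sum_{i=1}^{n-1}2^{n-1-i}v_i\bigr)\bmod 3$.
   Context: Define maps $\tau^{(n)}:\{0,1,2\}^n\to\{0,1,2\}^n$ recursively: $\tau^{(1)}$ is the identity, and for $n\ge2$, $\tau^{(n)}(v_1,\dots,v_n)=\bigl(v_1,\ \tau^{(n-1)}(2(v_1+v_2)\bmod 3,\dots,2(v_1+v_n)\bmod 3)\bigr)$. -}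

module Defs where

open import Data.Nat using (ℕ; zero; suc; _+_; _*_; _∸_; _^_)
open import Data.Nat.DivMod using (_%_; m%n<n)
import Data.Fin
open Data.Fin using (Fin; toℕ; fromℕ<; inject₁)
open import Data.Vec using (Vec; []; _∷_; map; lookup; last)

Z3 : Set
Z3 = Fin 3

step : Z3 → Z3 → Z3
step a x = fromℕ< ((m%n<n (2 * (toℕ a + toℕ x)) 3))

-- τ^(n) for n = suc m ≥ 1
τ : ∀ m → Vec Z3 (suc m) → Vec Z3 (suc m)
τ zero    (v ∷ [])     = v ∷ []
τ (suc m) (v₁ ∷ rest) = v₁ ∷ τ m (map (step v₁) rest)

Σ : ∀ m → (Fin m → ℕ) → ℕ
Σ zero    f = 0
Σ (suc m) f = f Data.Fin.zero + Σ m (λ i → f (Data.Fin.suc i))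

-- At its last coordinate the recursion reads t_{n+1}(v) = t_n(u) with u_k = 2(v₁ + v_{k+1}) mod 3, and
-- by induction t_n(u) ≡ 2^{n-1} R_n(u) for the weighted sum R_n of the statement. Expanding R_n(u)
-- mod 3 and using the geometric sum 1 + 2 + ⋯ + 2^{n-1} = 2^n - 1 gives R_n(u) ≡ 2 R_{n+1}(v),
-- which is exactly the inductive step.
module Submission where

open import Defs
open import Data.Nat using (ℕ; zero; suc; _+_; _*_; _∸_; _^_; NonZero)
open import Data.Nat.DivMod using (_%_; m%n%n≡m%n; %-distribˡ-+; %-distribˡ-*; m<n⇒m%n≡m; m%n<n)
open import Data.Nat.Properties using (*-zeroʳ; *-distribˡ-+; *-identityˡ; +-identityʳ; +-suc)
open import Data.Nat.Solver using (module +-*-Solver)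
open import Data.Fin using (Fin; toℕ; inject₁)
import Data.Fin as Fin
open import Data.Fin.Properties using (toℕ<n; toℕ-fromℕ<)
open import Data.Vec using (Vec; []; _∷_; map; lookup; last)
open import Data.Vec.Properties using (lookup-map)
open import Relation.Binary.PropositionalEquality
open import Relation.Binary.Bundles using (Setoid)
import Relation.Binary.Reasoning.Setoid
open import Level using (0ℓ)
open +-*-Solver using (solve; _:+_; _:*_; _:=_; con)

module Congruence (n : ℕ) .{{_ : NonZero n}} where

  -- A record rather than a function, so that the endpoints of a congruence can be inferred.
  infix 4 _≈_
  record _≈_ (a b : ℕ) : Set where
    constructor mod-≡
    field %-≡ : a % n ≡ b % n
  open _≈_ public

  ≈-setoid : Setoid 0ℓ 0ℓ
  ≈-setoid = record
    { Carrier       = ℕ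
    ; _≈_           = _≈_
    ; isEquivalence = record
      { refl  = mod-≡ refl
      ; sym   = λ a≈b → mod-≡ (sym (%-≡ a≈b))
      ; trans = λ a≈b b≈c → mod-≡ (trans (%-≡ a≈b) (%-≡ b≈c))
      }
    }

  %-≈ : ∀ a → a % n ≈ a
  %-≈ a = mod-≡ (m%n%n≡m%n a n)

  +-cong : ∀ {a b c d} → a ≈ b → c ≈ d → a + c ≈ b + d
  +-cong {a} {b} {c} {d} (mod-≡ a≡b) (mod-≡ c≡d) = mod-≡ (begin
    (a + c) % n              ≡⟨ %-distribˡ-+ a c n ⟩
    (a % n + c % n) % n      ≡⟨ cong₂ (λ x y → (x + y) % n) a≡b c≡d ⟩
    (b % n + d % n) % n      ≡⟨ %-distribˡ-+ b d n ⟨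
    (b + d) % n              ∎)
    where open ≡-Reasoning

  *-congˡ : ∀ c {a b} → a ≈ b → c * a ≈ c * b
  *-congˡ c {a} {b} (mod-≡ a≡b) = mod-≡ (begin
    (c * a) % n              ≡⟨ %-distribˡ-* c a n ⟩
    (c % n * (a % n)) % n    ≡⟨ cong (λ x → (c % n * x) % n) a≡b ⟩
    (c % n * (b % n)) % n    ≡⟨ %-distribˡ-* c b n ⟨
    (c * b) % n              ∎)
    where open ≡-Reasoning

  Σ-cong : ∀ m {f g : Fin m → ℕ} → (∀ j → f j ≈ g j) → Σ m f ≈ Σ m g
  Σ-cong zero    f≈g = mod-≡ refl
  Σ-cong (suc m) f≈g = +-cong (f≈g Fin.zero) (Σ-cong m (λ j → f≈g (Fin.suc j)))

open Congruence 3

Σ-ext : ∀ m {f g : Fin m → ℕ} → (∀ j → f j ≡ g j) → Σ m f ≡ Σ m g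
Σ-ext zero    f≡g = refl
Σ-ext (suc m) f≡g = cong₂ _+_ (f≡g Fin.zero) (Σ-ext m (λ j → f≡g (Fin.suc j)))

Σ-+ : ∀ m (f g : Fin m → ℕ) → Σ m (λ j → f j + g j) ≡ Σ m f + Σ m g
Σ-+ zero    f g = refl
Σ-+ (suc m) f g = begin
  (f₀ + g₀) + Σ m (λ j → f (Fin.suc j) + g (Fin.suc j))  ≡⟨ cong ((f₀ + g₀) +_) (Σ-+ m _ _) ⟩
  (f₀ + g₀) + (F + G)                                   ≡⟨ swap f₀ g₀ F G ⟩
  (f₀ + F) + (g₀ + G)                                   ∎
  where
  open ≡-Reasoning
  f₀ = f Fin.zero
  g₀ = g Fin.zero
  F = Σ m (λ j → f (Fin.suc j))
  G = Σ m (λ j → g (Fin.suc j))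
  swap : ∀ a b c d → (a + b) + (c + d) ≡ (a + c) + (b + d)
  swap = solve 4 (λ a b c d → (a :+ b) :+ (c :+ d) := (a :+ c) :+ (b :+ d)) refl

Σ-*ˡ : ∀ m c (f : Fin m → ℕ) → Σ m (λ j → c * f j) ≡ c * Σ m f
Σ-*ˡ zero    c f = sym (*-zeroʳ c)
Σ-*ˡ (suc m) c f = trans (cong (c * f Fin.zero +_) (Σ-*ˡ m c _)) (sym (*-distribˡ-+ c (f Fin.zero) _))

weight : ∀ m → Fin m → ℕ
weight m j = 2 ^ (m ∸ suc (toℕ j))

1+Σweight≡2^ : ∀ m → 1 + Σ m (weight m) ≡ 2 ^ m
1+Σweight≡2^ zero    = refl
1+Σweight≡2^ (suc m) = begin
  suc (2 ^ m + Σ m (weight m))   ≡⟨ +-suc (2 ^ m) _ ⟨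
  2 ^ m + (1 + Σ m (weight m))   ≡⟨ cong (2 ^ m +_) (1+Σweight≡2^ m) ⟩
  2 ^ m + 2 ^ m                  ≡⟨ solve 1 (λ x → x :+ x := con 2 :* x) refl (2 ^ m) ⟩
  2 * 2 ^ m                      ∎
  where open ≡-Reasoning

-- The paper's ṽ̃_n before its reduction mod 3, with n = m + 1.
R : ∀ m → Vec Z3 (suc m) → ℕ
R m v = toℕ (last v) + Σ m (λ j → weight m j * toℕ (lookup v (inject₁ j)))

last-map : ∀ {A B : Set} {m} (f : A → B) (xs : Vec A (suc m)) → last (map f xs) ≡ f (last xs)
last-map f (x ∷ [])     = refl
last-map f (x ∷ y ∷ xs) = last-map f (y ∷ xs)

toℕ-step : ∀ a x → toℕ (step a x) ≈ 2 * (toℕ a + toℕ x)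
toℕ-step a x = subst (_≈ 2 * (toℕ a + toℕ x)) (sym (toℕ-fromℕ< (m%n<n (2 * (toℕ a + toℕ x)) 3)))
                     (%-≈ (2 * (toℕ a + toℕ x)))

R-map-step : ∀ m a (v : Vec Z3 (suc m)) → R m (map (step a) v) ≈ 2 * R (suc m) (a ∷ v)
R-map-step m a v = begin
  R m (map (step a) v)
    ≈⟨ +-cong last-step (Σ-cong m (λ j → *-congˡ (w j) (lookup-step j))) ⟩
  2 * (A + L) + Σ m (λ j → w j * (2 * (A + x j)))
    ≡⟨ cong (2 * (A + L) +_) expand ⟩
  2 * (A + L) + (2 * A * W + 2 * S)
    ≡⟨ regroup A L S W ⟩
  2 * (L + ((1 + W) * A + S))
    ≡⟨ cong (λ P → 2 * (L + (P * A + S))) (1+Σweight≡2^ m) ⟩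
  2 * R (suc m) (a ∷ v)
    ∎
  where
  open Relation.Binary.Reasoning.Setoid ≈-setoid
  w = weight m
  x : Fin m → ℕ
  x j = toℕ (lookup v (inject₁ j))
  A = toℕ a
  L = toℕ (last v)
  W = Σ m w
  S = Σ m (λ j → w j * x j)
  last-step : toℕ (last (map (step a) v)) ≈ 2 * (A + L)
  last-step = subst (λ y → toℕ y ≈ 2 * (A + L)) (sym (last-map (step a) v)) (toℕ-step a (last v))
  lookup-step : ∀ j → toℕ (lookup (map (step a) v) (inject₁ j)) ≈ 2 * (A + x j)
  lookup-step j = subst (λ y → toℕ y ≈ 2 * (A + x j)) (sym (lookup-map (inject₁ j) (step a) v))
                        (toℕ-step a (lookup v (inject₁ j)))
  expand : Σ m (λ j → w j * (2 * (A + x j))) ≡ 2 * A * W + 2 * S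
  expand = ≡.begin
    Σ m (λ j → w j * (2 * (A + x j)))                     ≡.≡⟨ Σ-ext m (λ j → distribute (w j) A (x j)) ⟩
    Σ m (λ j → 2 * A * w j + 2 * (w j * x j))             ≡.≡⟨ Σ-+ m _ _ ⟩
    Σ m (λ j → 2 * A * w j) + Σ m (λ j → 2 * (w j * x j)) ≡.≡⟨ cong₂ _+_ (Σ-*ˡ m (2 * A) w) (Σ-*ˡ m 2 _) ⟩
    2 * A * W + 2 * S                                     ≡.∎
    where
    module ≡ = ≡-Reasoning
    distribute : ∀ w A x → w * (2 * (A + x)) ≡ 2 * A * w + 2 * (w * x)
    distribute = solve 3 (λ w A x → w :* (con 2 :* (A :+ x)) := con 2 :* A :* w :+ con 2 :* (w :* x)) refl
  regroup : ∀ A L S W → 2 * (A + L) + (2 * A * W + 2 * S) ≡ 2 * (L + ((1 + W) * A + S))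
  regroup = solve 4 (λ A L S W → con 2 :* (A :+ L) :+ (con 2 :* A :* W :+ con 2 :* S)
                              := con 2 :* (L :+ ((con 1 :+ W) :* A :+ S))) refl

theorem5 : (m : ℕ) (v : Vec Z3 (suc m)) →
    toℕ (last (τ m v))
      ≡ (2 ^ m * (toℕ (last v) + Σ m (λ j → 2 ^ (m ∸ suc (toℕ j)) * toℕ (lookup v (inject₁ j))))) % 3
theorem5 zero    (a ∷ []) = sym (begin
  (1 * (toℕ a + 0)) % 3  ≡⟨ cong (_% 3) (trans (*-identityˡ (toℕ a + 0)) (+-identityʳ (toℕ a))) ⟩
  toℕ a % 3              ≡⟨ m<n⇒m%n≡m (toℕ<n a) ⟩
  toℕ a                  ∎)
  where open ≡-Reasoning
theorem5 (suc m) (a ∷ v) = begin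
  toℕ (last (τ m (map (step a) v)))        ≡⟨ theorem5 m (map (step a) v) ⟩
  (2 ^ m * R m (map (step a) v)) % 3       ≡⟨ %-≡ (*-congˡ (2 ^ m) (R-map-step m a v)) ⟩
  (2 ^ m * (2 * R (suc m) (a ∷ v))) % 3    ≡⟨ cong (_% 3) (solve 2 (λ p r → p :* (con 2 :* r) := con 2 :* p :* r) refl (2 ^ m) _) ⟩
  (2 ^ suc m * R (suc m) (a ∷ v)) % 3      ∎
  where open ≡-Reasoning
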